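{- Let $p$ be an odd prime, $t>s\geq 1$, and let $k_1,k_2\in\mathbb{Z}_{p^{t-s}}^*$ be two distinct solutions of $k^2-k+1\equiv 0\pmod{p^{t-s}}$. Then $\mathrm{BiCay}(\mathcal{H}_{p,t,s},\emptyset,\emptyset,\{1,a,ba^{k_1}\})\cong\mathrm{BiCay}(\mathcal{H}_{p,t,s},\emptyset,\emptyset,\{1,a,ba^{k_2}\})$.
   Context: $\mathcal{H}_{p,t,s}=\langle a,b,c\mid a^{p^t}=b^{p^s}=c^p=1,\ [a,b]=c,\ [c,a]=[c,b]=1\rangle$ with $[x,y]=x^{ -1}y^{ -1}xy$. For a group $H$ and $S\subseteq H$, $\mathrm{BiCay}(H,\emptyset,\emptyset,S)$ is the graph with vertex set $H_0\cup H_1$ (two copies of $H$, $h_i$ the copy of $h$ in $H_i$) and edges $\{h_0,(zh)_1\}$ for $z\in S$, $h\in H$. -}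

module Defs where

open import Data.Nat using (ℕ; zero; suc; _+_; _*_; _∸_; _^_; NonZero)
open import Data.Nat.Properties using (m^n≢0)
open import Data.Nat.DivMod using (_mod_)
open import Data.Fin using (Fin; toℕ)
open import Data.Product using (Σ; _×_; _,_; ∃)
open import Data.List using (List; _∷_; [])
open import Data.List.Membership.Propositional using (_∈_)
open import Data.Empty using (⊥)
open import Data.Bool using (Bool; true; false)
open import Relation.Binary.PropositionalEquality using (_≡_)
open import Function.Bundles using (Inverse; _↔_; _⇔_)

-- Concrete model of H_{p,t,s} = < a,b,c | a^{p^t} = b^{p^s} = c^p = 1, [a,b] = c, c central >,
-- [x,y] = x⁻¹y⁻¹xy.  Every element has a unique normal form a^i b^j c^l with
-- i ∈ Z_{p^t}, j ∈ Z_{p^s}, l ∈ Z_p, represented by the triple (i , j , l).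
-- From ab = bac one gets b^j a^i = a^i b^j c^{-ij}, hence
-- (a^i1 b^j1 c^l1)(a^i2 b^j2 c^l2) = a^(i1+i2) b^(j1+j2) c^(l1+l2-j1*i2).
module _ (p t s : ℕ) .{{_ : NonZero p}} where

  private
    instance
      nzt : NonZero (p ^ t)
      nzt = m^n≢0 p t
      nzs : NonZero (p ^ s)
      nzs = m^n≢0 p s

  H : Set
  H = Fin (p ^ t) × Fin (p ^ s) × Fin p

  -- group multiplication; -x mod p is computed as (p ∸ 1) * x mod p
  _·_ : H → H → H
  (i₁ , j₁ , l₁) · (i₂ , j₂ , l₂) =
      ((toℕ i₁ + toℕ i₂) mod (p ^ t))
    , ((toℕ j₁ + toℕ j₂) mod (p ^ s))
    , ((toℕ l₁ + toℕ l₂ + (p ∸ 1) * (toℕ j₁ * toℕ i₂)) mod p)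

  e : H
  e = (0 mod (p ^ t)) , (0 mod (p ^ s)) , (0 mod p)

  a^ : ℕ → H
  a^ k = (k mod (p ^ t)) , (0 mod (p ^ s)) , (0 mod p)

  b : H
  b = (0 mod (p ^ t)) , (1 mod (p ^ s)) , (0 mod p)

  -- Vertices of BiCay(H, ∅, ∅, S): H₀ ∪ H₁, encoded as (false , h) = h₀ and (true , h) = h₁.
  Vertex : Set
  Vertex = Bool × H

  BiCayAdj : List H → Vertex → Vertex → Set
  BiCayAdj S (false , h) (true , g) = ∃ λ z → z ∈ S × g ≡ z · h
  BiCayAdj S (true , g) (false , h) = ∃ λ z → z ∈ S × g ≡ z · h
  BiCayAdj S (false , _) (false , _) = ⊥
  BiCayAdj S (true , _) (true , _) = ⊥

  BiCayIso : List H → List H → Set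
  BiCayIso S T = Σ (Vertex ↔ Vertex) λ f →
    ∀ u v → BiCayAdj S u v ⇔ BiCayAdj T (Inverse.to f u) (Inverse.to f v)

{-# OPTIONS --safe #-}
-- Two distinct roots k₁, k₂ of k² − k + 1 modulo N = p^(t−s) satisfy k₁ + k₂ ≡ 1, since N divides
-- (k₁ − k₂)(k₁ + k₂ − 1) but not k₁ − k₂: if p ∣ k₁ − k₂, then either N = p, or p² ∣ k₁² − k₁ + 1 and
-- p ∤ k₁ + k₂ − 1 (as 4(k₁² − k₁ + 1) − (2k₁ − 1)² = 3); either way N ∣ k₁ − k₂.
-- So m = 1 − k₁ − k₂ is a multiple of N, and a ↦ a, b ↦ a^m b⁻¹ c^k₂ defines an automorphism σ of
-- H_{p,t,s} with a·σ(1) = 1·σ(a) = b a^k₂ · σ(b a^k₁) = a. Hence h₀ ↦ (a σ(h))₁, h₁ ↦ σ(h)₀ carries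
-- the edges of BiCay(H, ∅, ∅, {1, a, b a^k₁}) onto those of BiCay(H, ∅, ∅, {1, a, b a^k₂}).
module Submission where

open import Defs
open import Data.Bool.Base using (true; false)
open import Data.Fin.Base using (Fin; toℕ; fromℕ<)
open import Data.Fin.Properties using (toℕ-fromℕ<; toℕ<n; toℕ-injective)
open import Data.List.Base using (List; _∷_; [])
open import Data.List.Membership.Propositional using (_∈_)
open import Data.List.Relation.Unary.Any using (here; there)
import Data.Nat.Base as ℕ
import Data.Nat.Properties as ℕ
import Data.Nat.Divisibility as ℕ
open import Data.Product.Base using (_×_; _,_; ∃)
open import Function.Base using (_∘_; id)
open import Function.Bundles using (Inverse; _↔_; mk↔ₛ′; _⇔_; mk⇔)
open import Level using (0ℓ)
open import Algebra.Core using (Op₁)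
open import Algebra.Structures using (IsGroup)
open import Relation.Binary.PropositionalEquality

module BiCayley (p t s : ℕ.ℕ) .{{_ : ℕ.NonZero p}} {_⁻¹ : Op₁ (H p t s)}
                (isGroup : IsGroup _≡_ (_·_ p t s) (e p t s) _⁻¹) where

  open import Algebra.Bundles using (Group)

  group : Group 0ℓ 0ℓ
  group = record { isGroup = isGroup }

  open Group group using (_∙_; _\\_; assoc)
  open import Algebra.Properties.Group group using (\\-leftDividesˡ; \\-leftDividesʳ; ∙-cancelˡ)

  -- h₀ ↦ (g σ(h))₁, h₁ ↦ σ(h)₀ sends the edge {h₀, (z h)₁} to {σ(z h)₀, (g σ(h))₁}, which lies in
  -- BiCay(H, ∅, ∅, T) exactly when g σ(h) = z′ σ(z) σ(h), i.e. z′ σ(z) = g, for some z′ ∈ T.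
  iso-by-automorphism : (σ : H p t s ↔ H p t s) →
    (∀ x y → Inverse.to σ (x ∙ y) ≡ Inverse.to σ x ∙ Inverse.to σ y) →
    (g : H p t s) {S T : List (H p t s)} →
    (∀ {z} → z ∈ S → ∃ λ z′ → z′ ∈ T × z′ ∙ Inverse.to σ z ≡ g) →
    (∀ {z′} → z′ ∈ T → ∃ λ z → z ∈ S × z′ ∙ Inverse.to σ z ≡ g) →
    BiCayIso p t s S T
  iso-by-automorphism σ σ-homo g {S} {T} S→T T→S = mk↔ₛ′ φ φ⁻¹ φ∘φ⁻¹ φ⁻¹∘φ , adjacency
    where
      open Inverse σ using (to; from; strictlyInverseˡ; strictlyInverseʳ)

      to-injective : ∀ {x y} → to x ≡ to y → x ≡ y
      to-injective {x} {y} eq = trans (sym (strictlyInverseʳ x)) (trans (cong from eq) (strictlyInverseʳ y))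

      φ φ⁻¹ : Vertex p t s → Vertex p t s
      φ (false , h) = true , g ∙ to h
      φ (true , h) = false , to h
      φ⁻¹ (true , h) = false , from (g \\ h)
      φ⁻¹ (false , h) = true , from h

      φ∘φ⁻¹ : ∀ v → φ (φ⁻¹ v) ≡ v
      φ∘φ⁻¹ (true , h) = cong (true ,_) (trans (cong (g ∙_) (strictlyInverseˡ (g \\ h))) (\\-leftDividesˡ g h))
      φ∘φ⁻¹ (false , h) = cong (false ,_) (strictlyInverseˡ h)

      φ⁻¹∘φ : ∀ v → φ⁻¹ (φ v) ≡ v
      φ⁻¹∘φ (false , h) = cong (false ,_) (trans (cong from (\\-leftDividesʳ g (to h))) (strictlyInverseʳ h))
      φ⁻¹∘φ (true , h) = cong (true ,_) (strictlyInverseʳ h)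

      translate : ∀ {z z′} → z′ ∙ to z ≡ g → ∀ h → g ∙ to h ≡ z′ ∙ to (z ∙ h)
      translate {z} {z′} z′σz≡g h = begin
        g ∙ to h             ≡⟨ cong (_∙ to h) z′σz≡g ⟨
        (z′ ∙ to z) ∙ to h   ≡⟨ assoc z′ (to z) (to h) ⟩
        z′ ∙ (to z ∙ to h)   ≡⟨ cong (z′ ∙_) (σ-homo z h) ⟨
        z′ ∙ to (z ∙ h)      ∎
        where open ≡-Reasoning

      edge⇔ : ∀ h h′ → (∃ λ z → z ∈ S × h′ ≡ z ∙ h) ⇔ (∃ λ z′ → z′ ∈ T × g ∙ to h ≡ z′ ∙ to h′)
      edge⇔ h h′ = mk⇔ forward backward
        where
          forward : (∃ λ z → z ∈ S × h′ ≡ z ∙ h) → ∃ λ z′ → z′ ∈ T × g ∙ to h ≡ z′ ∙ to h′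
          forward (z , z∈S , refl) with S→T z∈S
          ... | z′ , z′∈T , z′σz≡g = z′ , z′∈T , translate z′σz≡g h
          backward : (∃ λ z′ → z′ ∈ T × g ∙ to h ≡ z′ ∙ to h′) → ∃ λ z → z ∈ S × h′ ≡ z ∙ h
          backward (z′ , z′∈T , g∙σh≡z′∙σh′) with T→S z′∈T
          ... | z , z∈S , z′σz≡g = z , z∈S ,
            to-injective (∙-cancelˡ z′ (to h′) (to (z ∙ h)) (trans (sym g∙σh≡z′∙σh′) (translate z′σz≡g h)))

      adjacency : ∀ u v → BiCayAdj p t s S u v ⇔ BiCayAdj p t s T (φ u) (φ v)
      adjacency (false , h) (true , h′) = edge⇔ h h′
      adjacency (true , h′) (false , h) = edge⇔ h h′
      adjacency (false , _) (false , _) = mk⇔ id id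
      adjacency (true , _) (true , _) = mk⇔ id id

module IntegerCongruence where

  open import Data.Integer.Base using (ℤ; +_; -_; _+_; _-_; _*_; 0ℤ; 1ℤ; -1ℤ; ∣_∣; _/ℕ_; _%ℕ_)
  open import Data.Integer.Properties
    using (+-injective; pos-*; ∣i∣≡0⇒i≡0; i-j≡0⇒i≡j; [+m]-[+n]≡m⊖n; ∣m⊝n∣≤m⊔n)
  open import Data.Integer.DivMod using (n%ℕd<d; a≡a%ℕn+[a/ℕn]*n)
  open import Data.Integer.Divisibility.Signed
  open import Data.Integer.Tactic.RingSolver using (solve-∀)
  open import Data.Nat.DivMod using (m<n⇒m%n≡m)
  open import Relation.Binary.Structures using (IsEquivalence)
  open import Relation.Binary.Bundles using (Setoid)
  import Relation.Binary.Reasoning.Setoid as SetoidReasoning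

  infix 4 _≡_mod_
  record _≡_mod_ (x y : ℤ) (n : ℕ.ℕ) : Set where
    constructor ∣-diff
    field n∣x-y : + n ∣ x - y

  module _ {n : ℕ.ℕ} where

    ≡⇒≡-mod : ∀ {x y} → x ≡ y → x ≡ y mod n
    ≡⇒≡-mod {x} refl = ∣-diff (divides 0ℤ (x-x≡0*n x (+ n)))
      where x-x≡0*n : ∀ x n → x - x ≡ 0ℤ * n
            x-x≡0*n = solve-∀

    ≡-mod-sym : ∀ {x y} → x ≡ y mod n → y ≡ x mod n
    ≡-mod-sym {x} {y} (∣-diff n∣x-y) = ∣-diff (subst (+ n ∣_) (neg-sub x y) (∣m⇒∣-m n∣x-y))
      where neg-sub : ∀ x y → - (x - y) ≡ y - x
            neg-sub = solve-∀

    ≡-mod-trans : ∀ {x y z} → x ≡ y mod n → y ≡ z mod n → x ≡ z mod n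
    ≡-mod-trans {x} {y} {z} (∣-diff n∣x-y) (∣-diff n∣y-z) =
      ∣-diff (subst (+ n ∣_) (telescope x y z) (∣m∣n⇒∣m+n n∣x-y n∣y-z))
      where telescope : ∀ x y z → (x - y) + (y - z) ≡ x - z
            telescope = solve-∀

    ≡-mod-refl : ∀ x → x ≡ x mod n
    ≡-mod-refl x = ≡⇒≡-mod {x} refl

    ≡-mod-isEquivalence : IsEquivalence (λ x y → x ≡ y mod n)
    ≡-mod-isEquivalence = record
      { refl = ≡-mod-refl _ ; sym = ≡-mod-sym ; trans = ≡-mod-trans }

    +-cong-mod : ∀ {x y u v} → x ≡ y mod n → u ≡ v mod n → x + u ≡ y + v mod n
    +-cong-mod {x} {y} {u} {v} (∣-diff n∣x-y) (∣-diff n∣u-v) =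
      ∣-diff (subst (+ n ∣_) (regroup x y u v) (∣m∣n⇒∣m+n n∣x-y n∣u-v))
      where regroup : ∀ x y u v → (x - y) + (u - v) ≡ (x + u) - (y + v)
            regroup = solve-∀

    -‿cong-mod : ∀ {x y} → x ≡ y mod n → - x ≡ - y mod n
    -‿cong-mod {x} {y} (∣-diff n∣x-y) = ∣-diff (subst (+ n ∣_) (neg-distrib x y) (∣m⇒∣-m n∣x-y))
      where neg-distrib : ∀ x y → - (x - y) ≡ - x - - y
            neg-distrib = solve-∀

    *-cong-mod : ∀ {x y u v} → x ≡ y mod n → u ≡ v mod n → x * u ≡ y * v mod n
    *-cong-mod {x} {y} {u} {v} (∣-diff n∣x-y) (∣-diff n∣u-v) =
      ∣-diff (subst (+ n ∣_) (regroup x y u v) (∣m∣n⇒∣m+n (∣m⇒∣m*n u n∣x-y) (∣n⇒∣m*n y n∣u-v)))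
      where regroup : ∀ x y u v → (x - y) * u + y * (u - v) ≡ x * u - y * v
            regroup = solve-∀

  ≡-mod-setoid : ℕ.ℕ → Setoid 0ℓ 0ℓ
  ≡-mod-setoid n = record { Carrier = ℤ ; _≈_ = λ x y → x ≡ y mod n ; isEquivalence = ≡-mod-isEquivalence }

  module ≡-mod-Reasoning (n : ℕ.ℕ) = SetoidReasoning (≡-mod-setoid n)

  ≡-mod-weaken : ∀ {d n x y} → d ℕ.∣ n → x ≡ y mod n → x ≡ y mod d
  ≡-mod-weaken d∣n (∣-diff n∣x-y) = ∣-diff (∣-trans (∣ᵤ⇒∣ d∣n) n∣x-y)

  *-cong-mod-multiple : ∀ {a b x y z} → x ≡ y mod a → + b ∣ z → x * z ≡ y * z mod (a ℕ.* b)
  *-cong-mod-multiple {a} {b} {x} {y} {z} (∣-diff (divides q x-y≡qa)) (divides r z≡rb) =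
    ∣-diff (divides (q * r) (begin
      x * z - y * z           ≡⟨ factor x y z ⟩
      (x - y) * z             ≡⟨ cong₂ _*_ x-y≡qa z≡rb ⟩
      q * + a * (r * + b)     ≡⟨ regroup q r (+ a) (+ b) ⟩
      q * r * (+ a * + b)     ≡⟨ cong (q * r *_) (pos-* a b) ⟨
      q * r * + (a ℕ.* b)     ∎))
    where open ≡-Reasoning
          factor : ∀ x y z → x * z - y * z ≡ (x - y) * z
          factor = solve-∀
          regroup : ∀ q r a b → q * a * (r * b) ≡ q * r * (a * b)
          regroup = solve-∀

  +-≡-mod⇒≡ : ∀ {n a b} → a ℕ.< n → b ℕ.< n → + a ≡ + b mod n → a ≡ b
  +-≡-mod⇒≡ {ℕ.suc n} {a} {b} a<n b<n (∣-diff n∣a-b) =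
    +-injective (i-j≡0⇒i≡j (+ a) (+ b) (∣i∣≡0⇒i≡0 ∣a-b∣≡0))
    where
      ∣a-b∣<n : ∣ + a - + b ∣ ℕ.< ℕ.suc n
      ∣a-b∣<n = ℕ.≤-<-trans (subst ((ℕ._≤ a ℕ.⊔ b) ∘ ∣_∣) (sym ([+m]-[+n]≡m⊖n a b)) (∣m⊝n∣≤m⊔n a b))
                  (ℕ.⊔-pres-<m a<n b<n)
      ∣a-b∣≡0 : ∣ + a - + b ∣ ≡ 0
      ∣a-b∣≡0 = trans (sym (m<n⇒m%n≡m ∣a-b∣<n)) (ℕ.n∣m⇒m%n≡0 _ _ (∣⇒∣ᵤ n∣a-b))

  n∸1≡-1 : ∀ n .{{_ : ℕ.NonZero n}} → + (n ℕ.∸ 1) ≡ -1ℤ mod n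
  n∸1≡-1 (ℕ.suc n) = ∣-diff (divides 1ℤ (shift (+ n)))
    where shift : ∀ x → x - -1ℤ ≡ 1ℤ * (1ℤ + x)
          shift = solve-∀

  fromℤ : (n : ℕ.ℕ) .{{_ : ℕ.NonZero n}} → ℤ → Fin n
  fromℤ n x = fromℕ< (n%ℕd<d x n)

  toℕ-fromℤ : ∀ n .{{_ : ℕ.NonZero n}} x → + toℕ (fromℤ n x) ≡ x mod n
  toℕ-fromℤ n x = ≡-mod-sym (∣-diff (divides (x /ℕ n) (begin
      x - + toℕ (fromℤ n x)              ≡⟨ cong (λ r → x - + r) (toℕ-fromℕ< (n%ℕd<d x n)) ⟩
      x - + (x %ℕ n)                     ≡⟨ cong (_- + (x %ℕ n)) (a≡a%ℕn+[a/ℕn]*n x n) ⟩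
      + (x %ℕ n) + x /ℕ n * + n - + (x %ℕ n) ≡⟨ cancel (+ (x %ℕ n)) (x /ℕ n * + n) ⟩
      x /ℕ n * + n                       ∎)))
    where open ≡-Reasoning
          cancel : ∀ r y → r + y - r ≡ y
          cancel = solve-∀

  toℕ-injective-mod : ∀ {n} {i j : Fin n} → + toℕ i ≡ + toℕ j mod n → i ≡ j
  toℕ-injective-mod {i = i} {j} = toℕ-injective ∘ +-≡-mod⇒≡ (toℕ<n i) (toℕ<n j)

module SixthCyclotomic where

  open IntegerCongruence
  open import Data.Integer.Base using (ℤ; +_; _+_; _-_; _*_; 1ℤ; _⊖_)
  open import Data.Integer.Properties using (pos-+; pos-*; abs-*; ⊖-≥; [+m]-[+n]≡m⊖n; *-comm)
  open import Data.Integer.Divisibility.Signed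
  open import Data.Integer.Tactic.RingSolver using (solve-∀)
  import Data.Nat.Tactic.RingSolver as ℕ-Solver
  open import Data.Nat.Primality using (Prime; euclidsLemma; prime⇒nonZero; prime⇒nonTrivial)
  open import Data.Sum.Base using (inj₁; inj₂)
  open import Data.Empty using (⊥-elim)
  open import Relation.Nullary using (¬_; Dec; yes; no; contradiction)

  Φ₆ : ℤ → ℤ
  Φ₆ x = x * x - x + 1ℤ

  ∣k²-k+1⇒∣Φ₆ : ∀ {n} k → n ℕ.∣ k ℕ.* k ℕ.∸ k ℕ.+ 1 → + n ∣ Φ₆ (+ k)
  ∣k²-k+1⇒∣Φ₆ {n} k n∣Φ₆k = subst (+ n ∣_) Φ₆-pos (∣ᵤ⇒∣ n∣Φ₆k)
    where
      open ≡-Reasoning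
      m≤m*m : ∀ m → m ℕ.≤ m ℕ.* m
      m≤m*m ℕ.zero = ℕ.z≤n
      m≤m*m m@(ℕ.suc _) = ℕ.m≤m*n m m
      Φ₆-pos : + (k ℕ.* k ℕ.∸ k ℕ.+ 1) ≡ Φ₆ (+ k)
      Φ₆-pos = begin
        + (k ℕ.* k ℕ.∸ k ℕ.+ 1)  ≡⟨ pos-+ (k ℕ.* k ℕ.∸ k) 1 ⟩
        + (k ℕ.* k ℕ.∸ k) + 1ℤ   ≡⟨ cong (_+ 1ℤ) (⊖-≥ (m≤m*m k)) ⟨
        k ℕ.* k ⊖ k + 1ℤ         ≡⟨ cong (_+ 1ℤ) ([+m]-[+n]≡m⊖n (k ℕ.* k) k) ⟨
        + (k ℕ.* k) - + k + 1ℤ   ≡⟨ cong (λ k² → k² - + k + 1ℤ) (pos-* k k) ⟩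
        Φ₆ (+ k)                 ∎

  p^e∣m*n∧p∤m⇒p^e∣n : ∀ {p m} → Prime p → ¬ p ℕ.∣ m → ∀ e {n} → p ℕ.^ e ℕ.∣ m ℕ.* n → p ℕ.^ e ℕ.∣ n
  p^e∣m*n∧p∤m⇒p^e∣n _ _ ℕ.zero {n} _ = ℕ.1∣ n
  p^e∣m*n∧p∤m⇒p^e∣n {p} {m} p-prime p∤m (ℕ.suc e) {n} p^[1+e]∣mn
    with euclidsLemma m n p-prime (ℕ.∣-trans (ℕ.m∣m*n (p ℕ.^ e)) p^[1+e]∣mn)
  ... | inj₁ p∣m = contradiction p∣m p∤m
  ... | inj₂ (ℕ.divides n′ refl) = subst (p ℕ.^ ℕ.suc e ℕ.∣_) (ℕ.*-comm p n′) (ℕ.*-monoʳ-∣ p p^e∣n′)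
    where
      instance
        p≢0 : ℕ.NonZero p
        p≢0 = prime⇒nonZero p-prime
      regroup : ∀ m n′ p → m ℕ.* (n′ ℕ.* p) ≡ p ℕ.* (m ℕ.* n′)
      regroup = ℕ-Solver.solve-∀
      p^e∣n′ : p ℕ.^ e ℕ.∣ n′
      p^e∣n′ = p^e∣m*n∧p∤m⇒p^e∣n p-prime p∤m e
                 (ℕ.*-cancelˡ-∣ p (subst (p ℕ.^ ℕ.suc e ℕ.∣_) (regroup m n′ p) p^[1+e]∣mn))

  p^e∣i*j∧p∤i⇒p^e∣j : ∀ {p i j} → Prime p → ¬ + p ∣ i → ∀ e → + (p ℕ.^ e) ∣ i * j → + (p ℕ.^ e) ∣ j
  p^e∣i*j∧p∤i⇒p^e∣j {p} {i} {j} p-prime p∤i e p^e∣ij = ∣ᵤ⇒∣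
    (p^e∣m*n∧p∤m⇒p^e∣n p-prime (p∤i ∘ ∣ᵤ⇒∣) e (subst (p ℕ.^ e ℕ.∣_) (abs-* i j) (∣⇒∣ᵤ p^e∣ij)))

  p∣2x-1⇒p²∤Φ₆ : ∀ {p} x → 2 ℕ.≤ p → + p ∣ x + x - 1ℤ → ¬ + (p ℕ.* p) ∣ Φ₆ x
  p∣2x-1⇒p²∤Φ₆ {p} x 2≤p p∣w p²∣Φ₆x = ℕ.≤⇒≯ (ℕ.∣⇒≤ (∣⇒∣ᵤ p²∣3)) (ℕ.*-mono-≤ 2≤p 2≤p)
    where
      w : ℤ
      w = x + x - 1ℤ
      four-Φ₆ : ∀ x → + 4 * (x * x - x + 1ℤ) ≡ (x + x - 1ℤ) * (x + x - 1ℤ) + + 3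
      four-Φ₆ = solve-∀
      p²∣w² : + (p ℕ.* p) ∣ w * w
      p²∣w² = subst (_∣ w * w) (sym (pos-* p p)) (∣-trans (*-monoʳ-∣ (+ p) p∣w) (*-monoˡ-∣ w p∣w))
      p²∣3 : + (p ℕ.* p) ∣ + 3
      p²∣3 = ∣m+n∣m⇒∣n (subst (+ (p ℕ.* p) ∣_) (four-Φ₆ x) (∣n⇒∣m*n (+ 4) p²∣Φ₆x)) p²∣w²

  p∣x-y⇒p^e∣x-y : ∀ {p} → Prime p → ∀ e {x y} →
                  + (p ℕ.^ e) ∣ Φ₆ x → + (p ℕ.^ e) ∣ (x - y) * (x + y - 1ℤ) →
                  + p ∣ x - y → + (p ℕ.^ e) ∣ x - y
  p∣x-y⇒p^e∣x-y _ 0 _ _ _ = ∣ᵤ⇒∣ (ℕ.1∣ _)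
  p∣x-y⇒p^e∣x-y {p} _ 1 {x} {y} _ _ p∣x-y = subst (λ n → + n ∣ x - y) (sym (ℕ.*-identityʳ p)) p∣x-y
  p∣x-y⇒p^e∣x-y {p} p-prime e@(ℕ.suc (ℕ.suc e′)) {x} {y} N∣Φ₆x N∣[x-y][x+y-1] p∣x-y =
    p^e∣i*j∧p∤i⇒p^e∣j p-prime p∤x+y-1 e (subst (+ (p ℕ.^ e) ∣_) (*-comm (x - y) _) N∣[x-y][x+y-1])
    where
      sum : ∀ x y → (x - y) + (x + y - 1ℤ) ≡ x + x - 1ℤ
      sum = solve-∀
      p²∣N : + (p ℕ.* p) ∣ + (p ℕ.^ e)
      p²∣N = ∣ᵤ⇒∣ (ℕ.*-monoʳ-∣ p (ℕ.m∣m*n (p ℕ.^ e′)))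
      p∤x+y-1 : ¬ + p ∣ x + y - 1ℤ
      p∤x+y-1 p∣x+y-1 = p∣2x-1⇒p²∤Φ₆ x (ℕ.nonTrivial⇒n>1 p {{prime⇒nonTrivial p-prime}})
        (subst (+ p ∣_) (sum x y) (∣m∣n⇒∣m+n p∣x-y p∣x+y-1)) (∣-trans p²∣N N∣Φ₆x)

  Φ₆-roots-sum : ∀ {p} → Prime p → ∀ e {x y} → + (p ℕ.^ e) ∣ Φ₆ x → + (p ℕ.^ e) ∣ Φ₆ y →
                 ¬ x ≡ y mod p ℕ.^ e → x + y ≡ 1ℤ mod p ℕ.^ e
  Φ₆-roots-sum {p} p-prime e {x} {y} N∣Φ₆x N∣Φ₆y x≢y = ∣-diff (by-cases (+ p ∣? x - y))
    where
      difference : ∀ x y → (x * x - x + 1ℤ) - (y * y - y + 1ℤ) ≡ (x - y) * (x + y - 1ℤ)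
      difference = solve-∀
      N∣[x-y][x+y-1] : + (p ℕ.^ e) ∣ (x - y) * (x + y - 1ℤ)
      N∣[x-y][x+y-1] = subst (+ (p ℕ.^ e) ∣_) (difference x y) (∣m∣n⇒∣m-n N∣Φ₆x N∣Φ₆y)
      by-cases : Dec (+ p ∣ x - y) → + (p ℕ.^ e) ∣ x + y - 1ℤ
      by-cases (no p∤x-y) = p^e∣i*j∧p∤i⇒p^e∣j p-prime p∤x-y e N∣[x-y][x+y-1]
      by-cases (yes p∣x-y) = ⊥-elim (x≢y (∣-diff (p∣x-y⇒p^e∣x-y p-prime e {x} {y} N∣Φ₆x N∣[x-y][x+y-1] p∣x-y)))

module Heisenberg (p t s : ℕ.ℕ) .{{_ : ℕ.NonZero p}} (1≤s : 1 ℕ.≤ s) (s≤t : s ℕ.≤ t) where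

  open IntegerCongruence
  open import Data.Integer.Base using (ℤ; +_; -_; _+_; _-_; _*_; 0ℤ; 1ℤ; -1ℤ)
  open import Data.Integer.Properties
    using (pos-+; pos-*; +-assoc; +-identityˡ; +-identityʳ; +-inverseˡ; +-inverseʳ; neg-involutive)
  open import Data.Integer.Divisibility.Signed using (_∣_; ∣-trans; ∣ᵤ⇒∣; ∣n⇒∣m*n)
  open import Data.Integer.Tactic.RingSolver using (solve-∀)
  open import Data.Product.Base using (proj₁; proj₂)
  open import Algebra.Morphism.Structures using (IsGroupMonomorphism)
  import Algebra.Morphism.GroupMonomorphism as GroupMonomorphism
  open import Relation.Binary.Structures using (IsEquivalence)

  private
    instance
      p^t≢0 : ℕ.NonZero (p ℕ.^ t)
      p^t≢0 = ℕ.m^n≢0 p t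
      p^s≢0 : ℕ.NonZero (p ℕ.^ s)
      p^s≢0 = ℕ.m^n≢0 p s

  p∣p^n : ∀ {n} → 1 ℕ.≤ n → p ℕ.∣ p ℕ.^ n
  p∣p^n {ℕ.suc n} _ = ℕ.m∣m*n (p ℕ.^ n)

  -- The integer Heisenberg group, (i , j , l) standing for a^i b^j c^l; H p t s is its quotient by _≈_,
  -- and _⊗_ is the product of Defs before reduction modulo p^t, p^s, p.
  ℤ³ : Set
  ℤ³ = ℤ × ℤ × ℤ

  infixl 7 _⊗_
  _⊗_ : ℤ³ → ℤ³ → ℤ³
  (i₁ , j₁ , l₁) ⊗ (i₂ , j₂ , l₂) = i₁ + i₂ , j₁ + j₂ , l₁ + l₂ - j₁ * i₂

  ⊗-inverse : ℤ³ → ℤ³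
  ⊗-inverse (i , j , l) = - i , - j , - l - j * i

  0³ : ℤ³
  0³ = 0ℤ , 0ℤ , 0ℤ

  infix 4 _≈_
  record _≈_ (u v : ℤ³) : Set where
    constructor mk≈
    field
      ≈-a : proj₁ u ≡ proj₁ v mod p ℕ.^ t
      ≈-b : proj₁ (proj₂ u) ≡ proj₁ (proj₂ v) mod p ℕ.^ s
      ≈-c : proj₂ (proj₂ u) ≡ proj₂ (proj₂ v) mod p

  ≡⇒≈ : ∀ {u v} → u ≡ v → u ≈ v
  ≡⇒≈ refl = mk≈ (≡⇒≡-mod refl) (≡⇒≡-mod refl) (≡⇒≡-mod refl)

  ≈-isEquivalence : IsEquivalence _≈_
  ≈-isEquivalence = record
    { refl  = ≡⇒≈ refl
    ; sym   = λ (mk≈ i≡ j≡ l≡) → mk≈ (≡-mod-sym i≡) (≡-mod-sym j≡) (≡-mod-sym l≡)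
    ; trans = λ (mk≈ i≡ j≡ l≡) (mk≈ i≡′ j≡′ l≡′) →
                mk≈ (≡-mod-trans i≡ i≡′) (≡-mod-trans j≡ j≡′) (≡-mod-trans l≡ l≡′)
    }

  open IsEquivalence ≈-isEquivalence using () renaming (sym to ≈-sym; trans to ≈-trans)

  ⊗-cong : ∀ {u u′ v v′} → u ≈ u′ → v ≈ v′ → u ⊗ v ≈ u′ ⊗ v′
  ⊗-cong (mk≈ i₁≡ j₁≡ l₁≡) (mk≈ i₂≡ j₂≡ l₂≡) = mk≈ (+-cong-mod i₁≡ i₂≡) (+-cong-mod j₁≡ j₂≡)
    (+-cong-mod (+-cong-mod l₁≡ l₂≡) (-‿cong-mod (*-cong-mod
      (≡-mod-weaken (p∣p^n 1≤s) j₁≡) (≡-mod-weaken (p∣p^n (ℕ.≤-trans 1≤s s≤t)) i₂≡))))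

  ⊗-inverse-cong : ∀ {u v} → u ≈ v → ⊗-inverse u ≈ ⊗-inverse v
  ⊗-inverse-cong (mk≈ i≡ j≡ l≡) = mk≈ (-‿cong-mod i≡) (-‿cong-mod j≡)
    (+-cong-mod (-‿cong-mod l≡) (-‿cong-mod (*-cong-mod
      (≡-mod-weaken (p∣p^n 1≤s) j≡) (≡-mod-weaken (p∣p^n (ℕ.≤-trans 1≤s s≤t)) i≡))))

  ℤ³-isGroup : IsGroup _≈_ _⊗_ 0³ ⊗-inverse
  ℤ³-isGroup = record
    { isMonoid = record
      { isSemigroup = record
        { isMagma = record { isEquivalence = ≈-isEquivalence ; ∙-cong = ⊗-cong }
        ; assoc   = assoc
        }
      ; identity = identityˡ , identityʳ
      }
    ; inverse  = inverseˡ , inverseʳ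
    ; ⁻¹-cong  = ⊗-inverse-cong
    }
    where
      assoc : ∀ u v w → (u ⊗ v) ⊗ w ≈ u ⊗ (v ⊗ w)
      assoc (i₁ , j₁ , l₁) (i₂ , j₂ , l₂) (i₃ , j₃ , l₃) =
        ≡⇒≈ (cong₂ _,_ (+-assoc i₁ i₂ i₃) (cong₂ _,_ (+-assoc j₁ j₂ j₃) (c-assoc i₁ i₂ i₃ j₁ j₂ l₁ l₂ l₃)))
        where c-assoc : ∀ i₁ i₂ i₃ j₁ j₂ l₁ l₂ l₃ → l₁ + l₂ - j₁ * i₂ + l₃ - (j₁ + j₂) * i₃
                                                     ≡ l₁ + (l₂ + l₃ - j₂ * i₃) - j₁ * (i₂ + i₃)
              c-assoc = solve-∀
      identityˡ : ∀ u → 0³ ⊗ u ≈ u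
      identityˡ (i , j , l) = ≡⇒≈ (cong₂ _,_ (+-identityˡ i) (cong₂ _,_ (+-identityˡ j) (c-id i l)))
        where c-id : ∀ i l → 0ℤ + l - 0ℤ * i ≡ l
              c-id = solve-∀
      identityʳ : ∀ u → u ⊗ 0³ ≈ u
      identityʳ (i , j , l) = ≡⇒≈ (cong₂ _,_ (+-identityʳ i) (cong₂ _,_ (+-identityʳ j) (c-id j l)))
        where c-id : ∀ j l → l + 0ℤ - j * 0ℤ ≡ l
              c-id = solve-∀
      inverseˡ : ∀ u → ⊗-inverse u ⊗ u ≈ 0³
      inverseˡ (i , j , l) = ≡⇒≈ (cong₂ _,_ (+-inverseˡ i) (cong₂ _,_ (+-inverseˡ j) (c-inv i j l)))
        where c-inv : ∀ i j l → - l - j * i + l - (- j) * i ≡ 0ℤ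
              c-inv = solve-∀
      inverseʳ : ∀ u → u ⊗ ⊗-inverse u ≈ 0³
      inverseʳ (i , j , l) = ≡⇒≈ (cong₂ _,_ (+-inverseʳ i) (cong₂ _,_ (+-inverseʳ j) (c-inv i j l)))
        where c-inv : ∀ i j l → l + (- l - j * i) - j * (- i) ≡ 0ℤ
              c-inv = solve-∀

  ⟦_⟧ : H p t s → ℤ³
  ⟦ i , j , l ⟧ = + toℕ i , + toℕ j , + toℕ l

  reduce : ℤ³ → H p t s
  reduce (i , j , l) = fromℤ (p ℕ.^ t) i , fromℤ (p ℕ.^ s) j , fromℤ p l

  ⟦reduce⟧ : ∀ u → ⟦ reduce u ⟧ ≈ u
  ⟦reduce⟧ (i , j , l) = mk≈ (toℕ-fromℤ _ i) (toℕ-fromℤ _ j) (toℕ-fromℤ p l)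

  ⟦⟧-injective : ∀ {x y} → ⟦ x ⟧ ≈ ⟦ y ⟧ → x ≡ y
  ⟦⟧-injective (mk≈ i≡ j≡ l≡) =
    cong₂ _,_ (toℕ-injective-mod i≡) (cong₂ _,_ (toℕ-injective-mod j≡) (toℕ-injective-mod l≡))

  infixl 7 _∙_
  _∙_ : H p t s → H p t s → H p t s
  _∙_ = _·_ p t s

  ⟦⟧-homo : ∀ x y → ⟦ x ∙ y ⟧ ≈ ⟦ x ⟧ ⊗ ⟦ y ⟧
  ⟦⟧-homo (i₁ , j₁ , l₁) (i₂ , j₂ , l₂) =
    ≈-trans (⟦reduce⟧ (+ (I₁ ℕ.+ I₂) , + (J₁ ℕ.+ J₂) , + (L₁ ℕ.+ L₂ ℕ.+ (p ℕ.∸ 1) ℕ.* (J₁ ℕ.* I₂))))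
            (mk≈ (≡⇒≡-mod (pos-+ I₁ I₂)) (≡⇒≡-mod (pos-+ J₁ J₂)) c≡)
    where
      I₁ J₁ L₁ I₂ J₂ L₂ : ℕ.ℕ
      I₁ = toℕ i₁
      J₁ = toℕ j₁
      L₁ = toℕ l₁
      I₂ = toℕ i₂
      J₂ = toℕ j₂
      L₂ = toℕ l₂
      c-pos : + (L₁ ℕ.+ L₂ ℕ.+ (p ℕ.∸ 1) ℕ.* (J₁ ℕ.* I₂)) ≡ + L₁ + + L₂ + + (p ℕ.∸ 1) * (+ J₁ * + I₂)
      c-pos = trans (pos-+ (L₁ ℕ.+ L₂) _) (cong₂ _+_ (pos-+ L₁ L₂)
                (trans (pos-* (p ℕ.∸ 1) _) (cong (+ (p ℕ.∸ 1) *_) (pos-* J₁ I₂))))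
      minus : ∀ x y → x + -1ℤ * y ≡ x - y
      minus = solve-∀
      c≡ : + (L₁ ℕ.+ L₂ ℕ.+ (p ℕ.∸ 1) ℕ.* (J₁ ℕ.* I₂)) ≡ + L₁ + + L₂ - + J₁ * + I₂ mod p
      c≡ = begin
        + (L₁ ℕ.+ L₂ ℕ.+ (p ℕ.∸ 1) ℕ.* (J₁ ℕ.* I₂))    ≡⟨ c-pos ⟩
        + L₁ + + L₂ + + (p ℕ.∸ 1) * (+ J₁ * + I₂)     ≈⟨ +-cong-mod (≡-mod-refl (+ L₁ + + L₂))
                                                          (*-cong-mod (n∸1≡-1 p) (≡-mod-refl (+ J₁ * + I₂))) ⟩
        + L₁ + + L₂ + -1ℤ * (+ J₁ * + I₂)             ≡⟨ minus (+ L₁ + + L₂) (+ J₁ * + I₂) ⟩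
        + L₁ + + L₂ - + J₁ * + I₂                     ∎
        where open ≡-mod-Reasoning p

  infix 8 _⁻¹
  _⁻¹ : H p t s → H p t s
  x ⁻¹ = reduce (⊗-inverse ⟦ x ⟧)

  ⟦⟧-isGroupMonomorphism : IsGroupMonomorphism
    (record { Carrier = H p t s ; _≈_ = _≡_ ; _∙_ = _∙_ ; ε = e p t s ; _⁻¹ = _⁻¹ })
    (record { Carrier = ℤ³ ; _≈_ = _≈_ ; _∙_ = _⊗_ ; ε = 0³ ; _⁻¹ = ⊗-inverse })
    ⟦_⟧
  ⟦⟧-isGroupMonomorphism = record
    { isGroupHomomorphism = record
      { isMonoidHomomorphism = record
        { isMagmaHomomorphism = record
          { isRelHomomorphism = record { cong = ≡⇒≈ ∘ cong ⟦_⟧ }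
          ; homo              = ⟦⟧-homo
          }
        ; ε-homo = ⟦reduce⟧ 0³
        }
      ; ⁻¹-homo = ⟦reduce⟧ ∘ ⊗-inverse ∘ ⟦_⟧
      }
    ; injective = ⟦⟧-injective
    }

  H-isGroup : IsGroup _≡_ _∙_ (e p t s) _⁻¹
  H-isGroup = GroupMonomorphism.isGroup ⟦⟧-isGroupMonomorphism ℤ³-isGroup

  reduce-cong : ∀ {u v} → u ≈ v → reduce u ≡ reduce v
  reduce-cong {u} {v} u≈v = ⟦⟧-injective (≈-trans (⟦reduce⟧ u) (≈-trans u≈v (≈-sym (⟦reduce⟧ v))))

  reduce-⟦⟧ : ∀ x → reduce ⟦ x ⟧ ≡ x
  reduce-⟦⟧ x = ⟦⟧-injective (⟦reduce⟧ ⟦ x ⟧)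

  reduce-homo : ∀ u v → reduce u ∙ reduce v ≡ reduce (u ⊗ v)
  reduce-homo u v = ⟦⟧-injective (≈-trans (⟦⟧-homo (reduce u) (reduce v))
    (≈-trans (⊗-cong (⟦reduce⟧ u) (⟦reduce⟧ v)) (≈-sym (⟦reduce⟧ (u ⊗ v)))))

  module Automorphism (s<t : s ℕ.< t) (k₁ k₂ : ℕ.ℕ) (k₁+k₂≡1 : + k₁ + + k₂ ≡ 1ℤ mod p ℕ.^ (t ℕ.∸ s)) where

    open IsGroup H-isGroup using (identityˡ; identityʳ)

    m : ℤ
    m = 1ℤ - (+ k₁ + + k₂)

    N∣m : + (p ℕ.^ (t ℕ.∸ s)) ∣ m
    N∣m = _≡_mod_.n∣x-y (≡-mod-sym k₁+k₂≡1)

    p∣m : + p ∣ m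
    p∣m = ∣-trans (∣ᵤ⇒∣ (p∣p^n (ℕ.m<n⇒0<n∸m s<t))) N∣m

    -- ψ₃ d is a ↦ a, b ↦ a^m b⁻¹ c^d (so c ↦ c⁻¹); it respects b^(p^s) = 1 because p^(t−s) ∣ m,
    -- and ψ₃ (− d) is its inverse.
    ψ₃ : ℤ → ℤ³ → ℤ³
    ψ₃ d (i , j , l) = i + j * m , - j , d * j - l

    ψ₃-cong : ∀ d {u v} → u ≈ v → ψ₃ d u ≈ ψ₃ d v
    ψ₃-cong d {_ , j , _} {_ , j′ , _} (mk≈ i≡ j≡ l≡) =
      mk≈ (+-cong-mod i≡ (subst (λ n → j * m ≡ j′ * m mod n) p^s*p^[t-s]≡p^t (*-cong-mod-multiple j≡ N∣m)))
          (-‿cong-mod j≡)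
          (+-cong-mod (*-cong-mod (≡-mod-refl d) (≡-mod-weaken (p∣p^n 1≤s) j≡)) (-‿cong-mod l≡))
      where
        p^s*p^[t-s]≡p^t : p ℕ.^ s ℕ.* p ℕ.^ (t ℕ.∸ s) ≡ p ℕ.^ t
        p^s*p^[t-s]≡p^t = trans (sym (ℕ.^-distribˡ-+-* p s (t ℕ.∸ s))) (cong (p ℕ.^_) (ℕ.m+[n∸m]≡n s≤t))

    ψ₃-homo : ∀ d u v → ψ₃ d (u ⊗ v) ≈ ψ₃ d u ⊗ ψ₃ d v
    ψ₃-homo d (i₁ , j₁ , l₁) (i₂ , j₂ , l₂) =
      mk≈ (≡⇒≡-mod (a-homo i₁ i₂ j₁ j₂ m)) (≡⇒≡-mod (neg-distrib-+ j₁ j₂))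
          (∣-diff (subst (+ p ∣_) (sym (c-defect d i₂ j₁ j₂ l₁ l₂ m)) (∣n⇒∣m*n (- (j₁ * j₂)) p∣m)))
      where
        a-homo : ∀ i₁ i₂ j₁ j₂ m → i₁ + i₂ + (j₁ + j₂) * m ≡ i₁ + j₁ * m + (i₂ + j₂ * m)
        a-homo = solve-∀
        neg-distrib-+ : ∀ j₁ j₂ → - (j₁ + j₂) ≡ - j₁ + - j₂
        neg-distrib-+ = solve-∀
        c-defect : ∀ d i₂ j₁ j₂ l₁ l₂ m →
          d * (j₁ + j₂) - (l₁ + l₂ - j₁ * i₂) - ((d * j₁ - l₁) + (d * j₂ - l₂) - (- j₁) * (i₂ + j₂ * m))
          ≡ - (j₁ * j₂) * m
        c-defect = solve-∀

    ψ₃-inverse : ∀ d u → ψ₃ d (ψ₃ (- d) u) ≡ u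
    ψ₃-inverse d (i , j , l) = cong₂ _,_ (a-cancel i j m) (cong₂ _,_ (neg-involutive j) (c-cancel d j l))
      where
        a-cancel : ∀ i j m → i + j * m + (- j) * m ≡ i
        a-cancel = solve-∀
        c-cancel : ∀ d j l → d * (- j) - ((- d) * j - l) ≡ l
        c-cancel = solve-∀

    ψ : ℤ → H p t s → H p t s
    ψ d x = reduce (ψ₃ d ⟦ x ⟧)

    ψ-reduce : ∀ d u → ψ d (reduce u) ≡ reduce (ψ₃ d u)
    ψ-reduce d u = reduce-cong (ψ₃-cong d (⟦reduce⟧ u))

    ψ-inverse : ∀ d x → ψ d (ψ (- d) x) ≡ x
    ψ-inverse d x = trans (ψ-reduce d (ψ₃ (- d) ⟦ x ⟧)) (trans (cong reduce (ψ₃-inverse d ⟦ x ⟧)) (reduce-⟦⟧ x))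

    σ : H p t s → H p t s
    σ = ψ (+ k₂)

    σ-↔ : H p t s ↔ H p t s
    σ-↔ = mk↔ₛ′ σ (ψ (- + k₂)) (ψ-inverse (+ k₂)) σ⁻¹∘σ
      where
        σ⁻¹∘σ : ∀ x → ψ (- + k₂) (σ x) ≡ x
        σ⁻¹∘σ x = subst (λ d → ψ (- + k₂) (ψ d x) ≡ x) (neg-involutive (+ k₂)) (ψ-inverse (- + k₂) x)

    σ-homo : ∀ x y → σ (x ∙ y) ≡ σ x ∙ σ y
    σ-homo x y = begin
      σ (x ∙ y)                                   ≡⟨ reduce-cong (ψ₃-cong d (⟦⟧-homo x y)) ⟩
      reduce (ψ₃ d (⟦ x ⟧ ⊗ ⟦ y ⟧))               ≡⟨ reduce-cong (ψ₃-homo d ⟦ x ⟧ ⟦ y ⟧) ⟩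
      reduce (ψ₃ d ⟦ x ⟧ ⊗ ψ₃ d ⟦ y ⟧)            ≡⟨ reduce-homo (ψ₃ d ⟦ x ⟧) (ψ₃ d ⟦ y ⟧) ⟨
      σ x ∙ σ y                                   ∎
      where
        open ≡-Reasoning
        d : ℤ
        d = + k₂

    σ-fixes-a^ : ∀ k → σ (a^ p t s k) ≡ a^ p t s k
    σ-fixes-a^ k = trans (ψ-reduce (+ k₂) (+ k , 0ℤ , 0ℤ)) (cong reduce ψ₃-a)
      where
        a-fixed : ∀ k m → k + 0ℤ * m ≡ k
        a-fixed = solve-∀
        c-fixed : ∀ d → d * 0ℤ - 0ℤ ≡ 0ℤ
        c-fixed = solve-∀
        ψ₃-a : ψ₃ (+ k₂) (+ k , 0ℤ , 0ℤ) ≡ (+ k , 0ℤ , 0ℤ)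
        ψ₃-a = cong₂ _,_ (a-fixed (+ k) m) (cong₂ _,_ refl (c-fixed (+ k₂)))

    b·a^k₂·σ[b·a^k₁]≡a : (b p t s ∙ a^ p t s k₂) ∙ σ (b p t s ∙ a^ p t s k₁) ≡ a^ p t s 1
    b·a^k₂·σ[b·a^k₁]≡a = begin
      (b p t s ∙ a^ p t s k₂) ∙ σ (b p t s ∙ a^ p t s k₁)
        ≡⟨ cong₂ (λ x y → x ∙ σ y) (reduce-homo b₃ (a₃ k₂)) (reduce-homo b₃ (a₃ k₁)) ⟩
      reduce (b₃ ⊗ a₃ k₂) ∙ σ (reduce (b₃ ⊗ a₃ k₁))
        ≡⟨ cong (reduce (b₃ ⊗ a₃ k₂) ∙_) (ψ-reduce (+ k₂) (b₃ ⊗ a₃ k₁)) ⟩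
      reduce (b₃ ⊗ a₃ k₂) ∙ reduce (ψ₃ (+ k₂) (b₃ ⊗ a₃ k₁))
        ≡⟨ reduce-homo (b₃ ⊗ a₃ k₂) (ψ₃ (+ k₂) (b₃ ⊗ a₃ k₁)) ⟩
      reduce (b₃ ⊗ a₃ k₂ ⊗ ψ₃ (+ k₂) (b₃ ⊗ a₃ k₁))
        ≡⟨ reduce-cong product≈a ⟩
      a^ p t s 1
        ∎
      where
        open ≡-Reasoning
        b₃ : ℤ³
        b₃ = 0ℤ , 1ℤ , 0ℤ
        a₃ : ℕ.ℕ → ℤ³
        a₃ k = + k , 0ℤ , 0ℤ
        a-sum : ∀ x y → 0ℤ + y + (0ℤ + x + (1ℤ + 0ℤ) * (1ℤ - (x + y))) ≡ 1ℤ
        a-sum = solve-∀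
        b-cancel : ∀ x → x + 0ℤ + - (x + 0ℤ) ≡ 0ℤ
        b-cancel = solve-∀
        c-defect : ∀ x y m → 0ℤ + 0ℤ - 1ℤ * y + (y * (1ℤ + 0ℤ) - (0ℤ + 0ℤ - 1ℤ * x))
                             - (1ℤ + 0ℤ) * (0ℤ + x + (1ℤ + 0ℤ) * m) - 0ℤ ≡ -1ℤ * m
        c-defect = solve-∀
        product≈a : b₃ ⊗ a₃ k₂ ⊗ ψ₃ (+ k₂) (b₃ ⊗ a₃ k₁) ≈ (1ℤ , 0ℤ , 0ℤ)
        product≈a = mk≈ (≡⇒≡-mod (a-sum (+ k₁) (+ k₂))) (≡⇒≡-mod (b-cancel 1ℤ))
          (∣-diff (subst (+ p ∣_) (sym (c-defect (+ k₁) (+ k₂) m)) (∣n⇒∣m*n -1ℤ p∣m)))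

    a·σ1≡a : a^ p t s 1 ∙ σ (e p t s) ≡ a^ p t s 1
    a·σ1≡a = trans (cong (a^ p t s 1 ∙_) (σ-fixes-a^ 0)) (identityʳ (a^ p t s 1))

    1·σa≡a : e p t s ∙ σ (a^ p t s 1) ≡ a^ p t s 1
    1·σa≡a = trans (identityˡ (σ (a^ p t s 1))) (σ-fixes-a^ 1)

    S T : List (H p t s)
    S = e p t s ∷ a^ p t s 1 ∷ b p t s ∙ a^ p t s k₁ ∷ []
    T = e p t s ∷ a^ p t s 1 ∷ b p t s ∙ a^ p t s k₂ ∷ []

    S→T : ∀ {z} → z ∈ S → ∃ λ z′ → z′ ∈ T × z′ ∙ σ z ≡ a^ p t s 1
    S→T (here refl) = a^ p t s 1 , there (here refl) , a·σ1≡a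
    S→T (there (here refl)) = e p t s , here refl , 1·σa≡a
    S→T (there (there (here refl))) = b p t s ∙ a^ p t s k₂ , there (there (here refl)) , b·a^k₂·σ[b·a^k₁]≡a

    T→S : ∀ {z′} → z′ ∈ T → ∃ λ z → z ∈ S × z′ ∙ σ z ≡ a^ p t s 1
    T→S (here refl) = a^ p t s 1 , there (here refl) , 1·σa≡a
    T→S (there (here refl)) = e p t s , here refl , a·σ1≡a
    T→S (there (there (here refl))) = b p t s ∙ a^ p t s k₁ , there (there (here refl)) , b·a^k₂·σ[b·a^k₁]≡a

open SixthCyclotomic using (Φ₆-roots-sum; ∣k²-k+1⇒∣Φ₆)
open IntegerCongruence using (+-≡-mod⇒≡)

open import Data.Nat using (ℕ; _+_; _*_; _∸_; _^_; _<_; _≤_; _%_; NonZero)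
open import Data.Nat.Divisibility using (_∣_)
open import Data.Nat.Primality using (Prime)
open import Data.Nat.Coprimality using (Coprime)
open import Data.List using (_∷_; [])
open import Relation.Binary.PropositionalEquality using (_≡_; _≢_)

lemma3p2 : (p t s : ℕ) .{{_ : NonZero p}} → Prime p → p % 2 ≡ 1 →
  1 ≤ s → s < t →
  (k₁ k₂ : ℕ) → k₁ < p ^ (t ∸ s) → k₂ < p ^ (t ∸ s) →
  Coprime k₁ (p ^ (t ∸ s)) → Coprime k₂ (p ^ (t ∸ s)) →
  p ^ (t ∸ s) ∣ k₁ * k₁ ∸ k₁ + 1 →
  p ^ (t ∸ s) ∣ k₂ * k₂ ∸ k₂ + 1 →
  k₁ ≢ k₂ →
  BiCayIso p t s
    (e p t s ∷ a^ p t s 1 ∷ _·_ p t s (b p t s) (a^ p t s k₁) ∷ [])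
    (e p t s ∷ a^ p t s 1 ∷ _·_ p t s (b p t s) (a^ p t s k₂) ∷ [])
lemma3p2 p t s p-prime _ 1≤s s<t k₁ k₂ k₁<N k₂<N _ _ N∣Φ₆[k₁] N∣Φ₆[k₂] k₁≢k₂ =
  BiCayley.iso-by-automorphism p t s H-isGroup σ-↔ σ-homo (a^ p t s 1) S→T T→S
  where
    open Heisenberg p t s 1≤s (ℕ.<⇒≤ s<t)
    open Automorphism s<t k₁ k₂ (Φ₆-roots-sum p-prime (t ∸ s)
      (∣k²-k+1⇒∣Φ₆ k₁ N∣Φ₆[k₁]) (∣k²-k+1⇒∣Φ₆ k₂ N∣Φ₆[k₂]) (k₁≢k₂ ∘ +-≡-mod⇒≡ k₁<N k₂<N))
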